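{- For every integer $n\geq 2$, $\mathrm{sat}^*(n,\mathcal{V}_2)=\mathrm{sat}^*(n,\Lambda_2)=n+1$.
   Context: $\mathcal{V}_2$ is the three-element poset with one element below two incomparable elements; $\Lambda_2$ is the three-element poset with two incomparable elements both below a third element. $\mathcal{B}_n$ is the Boolean lattice $(2^{[n]},\subseteq)$. A poset $\mathcal{P}'=(P',\le')$ is an induced subposet of $\mathcal{P}=(P,\le)$ if there is an injection $f:P'\to P$ with $u\le' v$ iff $f(u)\le f(v)$. A family $\mathcal{F}\subseteq 2^{[n]}$ (ordered by inclusion) is induced-$\mathcal{P}$-saturated in $\mathcal{B}_n$ if it contains no induced copy of $\mathcal{P}$, but every $\mathcal{F}'$ with $\mathcal{F}\subsetneq\mathcal{F}'\subseteq 2^{[n]}$ contains an induced copy of $\mathcal{P}$. $\mathrm{sat}^*(n,\mathcal{P})$ is the minimum size of an induced-$\mathcal{P}$-saturated family in $\mathcal{B}_n$. -}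

module Defs where

open import Data.Nat using (ℕ; _≤_)
open import Data.Fin using (Fin; zero; suc)
open import Data.Fin.Subset using (Subset; _⊆_)
open import Data.Bool using (Bool; true; false; T)
open import Data.List using (List; length)
open import Data.List.Membership.Propositional using (_∈_; _∉_)
open import Data.List.Relation.Unary.Unique.Propositional using (Unique)
open import Data.Product using (Σ; ∃; _×_; _,_)
open import Relation.Nullary using (¬_)
open import Function.Bundles using (_⇔_)
open import Function.Definitions using (Injective)
open import Relation.Binary.PropositionalEquality using (_≡_)

-- A finite poset on Fin k, given by its (Boolean) order relation u ≤ v.
-- (Only the two concrete 3-element posets below are used.)

V₂ : Fin 3 → Fin 3 → Bool
V₂ zero _ = true
V₂ (suc zero) (suc zero) = true
V₂ (suc (suc zero)) (suc (suc zero)) = true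
V₂ _ _ = false

Λ₂ : Fin 3 → Fin 3 → Bool
Λ₂ zero zero = true
Λ₂ (suc zero) (suc zero) = true
Λ₂ _ (suc (suc zero)) = true
Λ₂ _ _ = false

Family : ℕ → Set
Family n = List (Subset n)

HasInducedCopy : ∀ {k n} → (Fin k → Fin k → Bool) → Family n → Set
HasInducedCopy {k} {n} P F =
  Σ (Fin k → Subset n) λ f →
    Injective _≡_ _≡_ f
    × (∀ u → f u ∈ F)
    × (∀ u v → T (P u v) ⇔ (f u ⊆ f v))

InducedSaturated : ∀ {k} → (Fin k → Fin k → Bool) → (n : ℕ) → Family n → Set
InducedSaturated P n F =
  ¬ HasInducedCopy P F
  × (∀ (F' : Family n) → (∀ {A} → A ∈ F → A ∈ F') → (∃ λ A → A ∈ F' × A ∉ F)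
       → HasInducedCopy P F')

SatStarIs : ∀ {k} → (Fin k → Fin k → Bool) → (n m : ℕ) → Set
SatStarIs P n m =
  (Σ (Family n) λ F → Unique F × InducedSaturated P n F × length F ≡ m)
  × (∀ (F : Family n) → Unique F → InducedSaturated P n F → m ≤ length F)

-- Complementation is an order-reversing bijection of B_n that turns induced
-- copies of V₂ into induced copies of Λ₂, so both saturation numbers agree and
-- it suffices to treat V₂.
--
-- {[n]} ∪ {[n] ∖ {i} : i ∈ [n]} is induced-V₂-saturated and has n + 1 members.
-- Conversely, let F be induced-V₂-saturated. Adding a missing set B creates a
-- V₂ through B; from this, [n] ∈ F, and for every i there are Z ⊆ P in F with
-- i ∈ P ∖ Z. If P ∖ {i} ∉ F, the V₂ created by adding P ∖ {i} yields either a
-- V₂ inside F (impossible) or a strictly smaller such P. Descending on |P| gives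
-- Q_i with Q_i and Q_i ∖ {i} both in F. The sets Q_i ∖ {i} are pairwise
-- distinct, since Q_i ∖ {i} = Q_j ∖ {j} with i ≠ j would sit below Q_i and Q_j
-- as a V₂, and none of them is [n]; hence |F| ≥ n + 1.

module Submission where

open import Defs
open import Data.Nat using (ℕ; _≤_; suc)
open import Data.Product using (_×_)

open import Algebra.Definitions using (Involutive)
open import Data.Bool using (Bool; T; not) renaming (_≟_ to _≟ᵇ_)
open import Data.Bool.Properties using (not-involutive)
open import Data.Empty using (⊥-elim)
open import Data.Fin using (Fin; zero; suc; opposite)
open import Data.Fin.Properties using (¬∀⟶∃¬; injective⇒≤; opposite-involutive) renaming (_≟_ to _≟ᶠ_)
open import Data.Fin.Subset using (Subset; _⊆_; _⊈_; _⊂_; ⊤; ∁; _-_; ∣_∣) renaming (_∈_ to _∈ₛ_; _∉_ to _∉ₛ_)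
open import Data.Fin.Subset.Properties using (drop-there; ∈⊤; ⊆⊤; ⊆-antisym; _⊆?_; p─q⊆p; x∈p∧x≢y⇒x∈p-y; p⊂q⇒∣p∣<∣q∣; p⊆q⇒∁p⊇∁q; ∁p⊆∁q⇒p⊇q) renaming (_∈?_ to _∈ₛ?_)
open import Data.List using (List; _∷_; length; lookup; map; tabulate)
open import Data.List.Membership.Propositional using (_∈_; _∉_)
open import Data.List.Membership.Propositional.Properties using (∈-map⁺; ∈-map⁻; ∈-tabulate⁺; ∈-tabulate⁻)
open import Data.List.Properties using (length-map; length-tabulate)
open import Data.List.Relation.Unary.Any using (here; there; index)
open import Data.List.Relation.Unary.Any.Properties using (lookup-index)
open import Data.List.Relation.Unary.Unique.Propositional.Properties using (tabulate⁺; map⁺)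
open import Data.Nat using (_<_)
open import Data.Nat.Induction using (<-wellFounded)
open import Data.Product using (Σ; ∃; _,_; proj₁; proj₂)
open import Data.Unit using (tt)
open import Data.Vec using (_∷_) renaming (map to mapᵥ)
open import Data.Vec.Functional using () renaming (_∷_ to _◂_)
open import Data.Vec.Properties using (≡-dec; map-∘; map-cong; map-id)
open import Function.Base using (_∘_; id)
open import Function.Bundles using (_⇔_; mk⇔; Equivalence)
open import Function.Definitions using (Injective)
open import Induction.WellFounded using (Acc; acc)
open import Relation.Binary.PropositionalEquality using (_≡_; _≢_; refl; sym; trans; cong; cong₂; subst; module ≡-Reasoning)
open import Relation.Nullary using (¬_; yes; no)
open import Relation.Nullary.Decidable using (_→-dec_)

private
  variable
    n : ℕ
    x y : Fin n
    p q : Subset n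

x∉p-x : (p : Subset n) (x : Fin n) → x ∉ₛ p - x
x∉p-x (_ ∷ p) zero ()
x∉p-x (_ ∷ p) (suc x) x∈ = x∉p-x p x (drop-there x∈)

x∈p-y⇒x≢y : x ∈ₛ p - y → x ≢ y
x∈p-y⇒x≢y {p = p} x∈ refl = x∉p-x p _ x∈

p⊆q∧x∉p⇒p⊆q-x : p ⊆ q → x ∉ₛ p → p ⊆ q - x
p⊆q∧x∉p⇒p⊆q-x p⊆q x∉p y∈p = x∈p∧x≢y⇒x∈p-y (p⊆q y∈p) λ { refl → x∉p y∈p }

p-x⊆q∧x∈q⇒p⊆q : x ∈ₛ q → p - x ⊆ q → p ⊆ q
p-x⊆q∧x∈q⇒p⊆q {x = x} x∈q p-x⊆q {y} y∈p with y ≟ᶠ x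
... | yes refl = x∈q
... | no y≢x = p-x⊆q (x∈p∧x≢y⇒x∈p-y y∈p y≢x)

p⊈q⇒∃∈∉ : p ⊈ q → ∃ λ x → x ∈ₛ p × x ∉ₛ q
p⊈q⇒∃∈∉ {n} {p} {q} p⊈q
  with ¬∀⟶∃¬ n (λ x → x ∈ₛ p → x ∈ₛ q) (λ x → x ∈ₛ? p →-dec x ∈ₛ? q) (λ p⊆q → p⊈q (p⊆q _))
... | x , x∉ with x ∈ₛ? p
...   | yes x∈p = x , x∈p , λ x∈q → x∉ λ _ → x∈q
...   | no x∉p = ⊥-elim (x∉ λ x∈p → ⊥-elim (x∉p x∈p))

p⊆q∧p≢q⇒p⊂q : p ⊆ q → p ≢ q → p ⊂ q
p⊆q∧p≢q⇒p⊂q p⊆q p≢q = p⊆q , p⊈q⇒∃∈∉ λ q⊆p → p≢q (⊆-antisym p⊆q q⊆p)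

⊤-x⊆⊤-y⇒x≡y : ⊤ - x ⊆ ⊤ - y → x ≡ y
⊤-x⊆⊤-y⇒x≡y {x = x} {y} ⊆ with x ≟ᶠ y
... | yes x≡y = x≡y
... | no x≢y = ⊥-elim (x∉p-x ⊤ y (⊆ (x∈p∧x≢y⇒x∈p-y ∈⊤ (x≢y ∘ sym))))

⊤-x-injective : ⊤ - x ≡ ⊤ - y → x ≡ y
⊤-x-injective eq = ⊤-x⊆⊤-y⇒x≡y λ x∈ → subst (_ ∈ₛ_) eq x∈

⊤≢p-x : ⊤ ≢ p - x
⊤≢p-x {p = p} {x} eq = x∉p-x p x (subst (x ∈ₛ_) eq ∈⊤)

∁-involutive : (p : Subset n) → ∁ (∁ p) ≡ p
∁-involutive p = begin
  ∁ (∁ p)                  ≡⟨ map-∘ not not p ⟨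
  mapᵥ (not ∘ not) p       ≡⟨ map-cong not-involutive p ⟩
  mapᵥ id p                ≡⟨ map-id p ⟩
  p                        ∎
  where open ≡-Reasoning

∁-injective : ∁ p ≡ ∁ q → p ≡ q
∁-injective {p = p} {q} eq = begin
  p           ≡⟨ ∁-involutive p ⟨
  ∁ (∁ p)     ≡⟨ cong ∁ eq ⟩
  ∁ (∁ q)     ≡⟨ ∁-involutive q ⟩
  q           ∎
  where open ≡-Reasoning

◂-injective : ∀ {A : Set} {m} {a : A} {f : Fin m → A} →
              (∀ i → a ≢ f i) → Injective _≡_ _≡_ f → Injective _≡_ _≡_ (a ◂ f)
◂-injective a∉f f-inj {zero}  {zero}  _  = refl
◂-injective a∉f f-inj {zero}  {suc j} eq = ⊥-elim (a∉f j eq)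
◂-injective a∉f f-inj {suc i} {zero}  eq = ⊥-elim (a∉f i (sym eq))
◂-injective a∉f f-inj {suc i} {suc j} eq = cong suc (f-inj eq)

injective⇒≤length : ∀ {A : Set} {m} {xs : List A} (f : Fin m → A) →
                    Injective _≡_ _≡_ f → (∀ i → f i ∈ xs) → m ≤ length xs
injective⇒≤length {xs = xs} f f-inj f∈ = injective⇒≤ index-injective
  where
  index-injective : Injective _≡_ _≡_ (λ i → index (f∈ i))
  index-injective {i} {j} eq = f-inj (begin
    f i                      ≡⟨ lookup-index (f∈ i) ⟩
    lookup xs (index (f∈ i)) ≡⟨ cong (lookup xs) eq ⟩
    lookup xs (index (f∈ j)) ≡⟨ lookup-index (f∈ j) ⟨
    f j                      ∎)
    where open ≡-Reasoning

∈-∷⁻ : ∀ {A : Set} {a b : A} {xs : List A} → a ∈ b ∷ xs → a ≢ b → a ∈ xs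
∈-∷⁻ (here a≡b) a≢b = ⊥-elim (a≢b a≡b)
∈-∷⁻ (there a∈) _   = a∈

-- Induced copies of V₂

IsV₂ : Subset n → Subset n → Subset n → Set
IsV₂ Z D P = Z ⊆ D × Z ⊆ P × D ⊈ P × P ⊈ D

data V₂In (F : Family n) : Set where
  v₂ : ∀ {Z D P} → Z ∈ F → D ∈ F → P ∈ F → IsV₂ Z D P → V₂In F

module _ {Z D P : Subset n} where

  IsV₂-swap : IsV₂ Z D P → IsV₂ Z P D
  IsV₂-swap (Z⊆D , Z⊆P , D⊈P , P⊈D) = Z⊆P , Z⊆D , P⊈D , D⊈P

  IsV₂⇒bot≢top : IsV₂ Z D P → Z ≢ D
  IsV₂⇒bot≢top (_ , Z⊆P , D⊈P , _) refl = D⊈P Z⊆P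

  IsV₂⇒top≢top : IsV₂ Z D P → D ≢ P
  IsV₂⇒top≢top (_ , _ , D⊈P , _) refl = D⊈P λ d∈ → d∈

  IsV₂⇒top≢⊤ : IsV₂ Z D P → D ≢ ⊤
  IsV₂⇒top≢⊤ (_ , _ , _ , P⊈D) refl = P⊈D ⊆⊤

  IsV₂⇒bot≢⊤ : IsV₂ Z D P → Z ≢ ⊤
  IsV₂⇒bot≢⊤ V@(Z⊆D , _) refl = IsV₂⇒top≢⊤ V (⊆-antisym ⊆⊤ Z⊆D)

V₂In⇒copy : {F : Family n} → V₂In F → HasInducedCopy V₂ F
V₂In⇒copy {n} {F} (v₂ {Z} {D} {P} Z∈ D∈ P∈ V@(Z⊆D , Z⊆P , D⊈P , P⊈D)) = f , f-inj , f∈ , f-induced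
  where
  f : Fin 3 → Subset n
  f zero             = Z
  f (suc zero)       = D
  f (suc (suc zero)) = P

  f∈ : ∀ u → f u ∈ F
  f∈ zero             = Z∈
  f∈ (suc zero)       = D∈
  f∈ (suc (suc zero)) = P∈

  f-induced : ∀ u v → T (V₂ u v) ⇔ (f u ⊆ f v)
  f-induced zero             zero             = mk⇔ (λ _ {_} z∈ → z∈) (λ _ → tt)
  f-induced zero             (suc zero)       = mk⇔ (λ _ {_} → Z⊆D) (λ _ → tt)
  f-induced zero             (suc (suc zero)) = mk⇔ (λ _ {_} → Z⊆P) (λ _ → tt)
  f-induced (suc zero)       zero             = mk⇔ (λ ()) λ D⊆Z → D⊈P λ d∈ → Z⊆P (D⊆Z d∈)
  f-induced (suc zero)       (suc zero)       = mk⇔ (λ _ {_} z∈ → z∈) (λ _ → tt)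
  f-induced (suc zero)       (suc (suc zero)) = mk⇔ (λ ()) D⊈P
  f-induced (suc (suc zero)) zero             = mk⇔ (λ ()) λ P⊆Z → P⊈D λ p∈ → Z⊆D (P⊆Z p∈)
  f-induced (suc (suc zero)) (suc zero)       = mk⇔ (λ ()) P⊈D
  f-induced (suc (suc zero)) (suc (suc zero)) = mk⇔ (λ _ {_} z∈ → z∈) (λ _ → tt)

  f-inj : Injective _≡_ _≡_ f
  f-inj {zero}             {zero}             _  = refl
  f-inj {zero}             {suc zero}         eq = ⊥-elim (IsV₂⇒bot≢top V eq)
  f-inj {zero}             {suc (suc zero)}   eq = ⊥-elim (IsV₂⇒bot≢top (IsV₂-swap V) eq)
  f-inj {suc zero}         {zero}             eq = ⊥-elim (IsV₂⇒bot≢top V (sym eq))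
  f-inj {suc zero}         {suc zero}         _  = refl
  f-inj {suc zero}         {suc (suc zero)}   eq = ⊥-elim (IsV₂⇒top≢top V eq)
  f-inj {suc (suc zero)}   {zero}             eq = ⊥-elim (IsV₂⇒bot≢top (IsV₂-swap V) (sym eq))
  f-inj {suc (suc zero)}   {suc zero}         eq = ⊥-elim (IsV₂⇒top≢top V (sym eq))
  f-inj {suc (suc zero)}   {suc (suc zero)}   _  = refl

copy⇒V₂In : {F : Family n} → HasInducedCopy V₂ F → V₂In F
copy⇒V₂In (f , _ , f∈ , f-induced) =
  v₂ (f∈ zero) (f∈ (suc zero)) (f∈ (suc (suc zero)))
     ( Equivalence.to (f-induced zero (suc zero)) tt
     , Equivalence.to (f-induced zero (suc (suc zero))) tt
     , Equivalence.from (f-induced (suc zero) (suc (suc zero)))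
     , Equivalence.from (f-induced (suc (suc zero)) (suc zero)) )

-- Induced-V₂-saturated families have at least n + 1 members

data NewV₂ (F : Family n) (B : Subset n) : Set where
  B-bottom : ∀ {C D} → C ∈ F → D ∈ F → IsV₂ B C D → NewV₂ F B
  B-top    : ∀ {A C} → A ∈ F → C ∈ F → IsV₂ A B C → NewV₂ F B

newV₂ : {F : Family n} {B : Subset n} → ¬ V₂In F → V₂In (B ∷ F) → NewV₂ F B
newV₂ _ (v₂ (here refl) D∈ P∈ V) =
  B-bottom (∈-∷⁻ D∈ (IsV₂⇒bot≢top V ∘ sym)) (∈-∷⁻ P∈ (IsV₂⇒bot≢top (IsV₂-swap V) ∘ sym)) V
newV₂ _ (v₂ (there Z∈) (here refl) P∈ V) =
  B-top Z∈ (∈-∷⁻ P∈ (IsV₂⇒top≢top V ∘ sym)) V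
newV₂ _ (v₂ (there Z∈) (there D∈) (here refl) V) =
  B-top Z∈ D∈ (IsV₂-swap V)
newV₂ free (v₂ (there Z∈) (there D∈) (there P∈) V) = ⊥-elim (free (v₂ Z∈ D∈ P∈ V))

saturated⇒newV₂ : {F : Family n} → InducedSaturated V₂ n F → ∀ B → B ∉ F → NewV₂ F B
saturated⇒newV₂ {F = F} (free , saturated) B B∉F =
  newV₂ (free ∘ V₂In⇒copy) (copy⇒V₂In (saturated (B ∷ F) there (B , here refl , B∉F)))

module LowerBound {n} {F : Family n} (saturated : InducedSaturated V₂ n F) where
  open import Data.List.Membership.DecPropositional {A = Subset n} (≡-dec _≟ᵇ_) using (_∈?_)

  free : ¬ V₂In F
  free = proj₁ saturated ∘ V₂In⇒copy

  ⊤∈F : ⊤ ∈ F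
  ⊤∈F with ⊤ ∈? F
  ... | yes ⊤∈F = ⊤∈F
  ... | no ⊤∉F with saturated⇒newV₂ saturated ⊤ ⊤∉F
  ...   | B-bottom _ _ V = ⊥-elim (IsV₂⇒bot≢⊤ V refl)
  ...   | B-top    _ _ V = ⊥-elim (IsV₂⇒top≢⊤ V refl)

  avoider : ∀ i → ∃ λ Z → Z ∈ F × i ∉ₛ Z
  avoider i with (⊤ - i) ∈? F
  ... | yes ∈F = ⊤ - i , ∈F , x∉p-x ⊤ i
  ... | no ∉F with saturated⇒newV₂ saturated (⊤ - i) ∉F
  ...   | B-top A∈ _ V = _ , A∈ , λ i∈A → x∉p-x ⊤ i (proj₁ V i∈A)
  ...   | B-bottom {C} C∈ _ V with i ∈ₛ? C
  ...     | no i∉C  = C , C∈ , i∉C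
  ...     | yes i∈C = ⊥-elim (IsV₂⇒top≢⊤ V (⊆-antisym ⊆⊤ (p-x⊆q∧x∈q⇒p⊆q i∈C (proj₁ V))))

  record Straddle (i : Fin n) : Set where
    field
      low high : Subset n
      low∈     : low ∈ F
      high∈    : high ∈ F
      low⊆high : low ⊆ high
      i∉low    : i ∉ₛ low
      i∈high   : i ∈ₛ high

  record Cover (i : Fin n) : Set where
    field
      upper   : Subset n
      upper∈  : upper ∈ F
      i∈upper : i ∈ₛ upper
      lower∈  : upper - i ∈ F

  shrink : ∀ {i} (s : Straddle i) → Straddle.high s - i ∉ F →
           Σ (Straddle i) λ s′ → Straddle.high s′ ⊂ Straddle.high s
  shrink {i} s P-i∉F = go (saturated⇒newV₂ saturated (P - i) P-i∉F)
    where
    open Straddle s renaming (low to Z; high to P)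

    Z⊆P-i : Z ⊆ P - i
    Z⊆P-i = p⊆q∧x∉p⇒p⊆q-x low⊆high i∉low

    P-i⊆P : P - i ⊆ P
    P-i⊆P = p─q⊆p P _

    -- If i ∉ C, then Z, C, P would form a V₂ in F.
    above⇒⊇ : ∀ {C} → C ∈ F → P - i ⊆ C → P ⊆ C
    above⇒⊇ {C} C∈ P-i⊆C with i ∈ₛ? C
    ... | yes i∈C = p-x⊆q∧x∈q⇒p⊆q i∈C P-i⊆C
    ... | no i∉C  = ⊥-elim (free (v₂ low∈ C∈ high∈
                      ((λ z∈ → P-i⊆C (Z⊆P-i z∈)) , low⊆high , C⊈P , λ P⊆C → i∉C (P⊆C i∈high))))
      where
      C⊈P : C ⊈ P
      C⊈P C⊆P = P-i∉F (subst (_∈ F) (⊆-antisym (p⊆q∧x∉p⇒p⊆q-x C⊆P i∉C) P-i⊆C) C∈)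

    go : NewV₂ F (P - i) → Σ (Straddle i) λ s′ → Straddle.high s′ ⊂ P
    go (B-bottom C∈ D∈ (P-i⊆C , P-i⊆D , C⊈D , D⊈C)) =
      ⊥-elim (free (v₂ high∈ C∈ D∈ (above⇒⊇ C∈ P-i⊆C , above⇒⊇ D∈ P-i⊆D , C⊈D , D⊈C)))
    go (B-top {A} {C} A∈ C∈ (A⊆P-i , A⊆C , P-i⊈C , C⊈P-i)) = smaller , C⊆P , p⊈q⇒∃∈∉ P⊈C
      where
      P⊈C : P ⊈ C
      P⊈C P⊆C = P-i⊈C λ x∈ → P⊆C (P-i⊆P x∈)

      C⊆P : C ⊆ P
      C⊆P with C ⊆? P
      ... | yes C⊆P = C⊆P
      ... | no C⊈P  = ⊥-elim (free (v₂ A∈ C∈ high∈ (A⊆C , (λ a∈ → P-i⊆P (A⊆P-i a∈)) , C⊈P , P⊈C)))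

      i∈C : i ∈ₛ C
      i∈C with i ∈ₛ? C
      ... | yes i∈C = i∈C
      ... | no i∉C  = ⊥-elim (C⊈P-i (p⊆q∧x∉p⇒p⊆q-x C⊆P i∉C))

      smaller : Straddle i
      smaller = record
        { low = A ; high = C ; low∈ = A∈ ; high∈ = C∈ ; low⊆high = A⊆C
        ; i∉low = λ i∈A → x∉p-x P i (A⊆P-i i∈A) ; i∈high = i∈C }

  descend : ∀ {i} (s : Straddle i) → Acc _<_ ∣ Straddle.high s ∣ → Cover i
  descend {i} s (acc rec) with Straddle.high s - i ∈? F
  ... | yes ∈F = record { upper = Straddle.high s ; upper∈ = Straddle.high∈ s
                        ; i∈upper = Straddle.i∈high s ; lower∈ = ∈F }
  ... | no ∉F with shrink s ∉F
  ...   | s′ , s′⊂s = descend s′ (rec (p⊂q⇒∣p∣<∣q∣ s′⊂s))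

  cover : ∀ i → Cover i
  cover i = descend initial (<-wellFounded _)
    where
    initial : Straddle i
    initial = record
      { low = proj₁ (avoider i) ; high = ⊤ ; low∈ = proj₁ (proj₂ (avoider i)) ; high∈ = ⊤∈F
      ; low⊆high = ⊆⊤ ; i∉low = proj₂ (proj₂ (avoider i)) ; i∈high = ∈⊤ }

  open Cover

  lower : Fin n → Subset n
  lower i = upper (cover i) - i

  upper⊈upper : ∀ {i j} → i ≢ j → lower i ≡ lower j → upper (cover i) ⊈ upper (cover j)
  upper⊈upper {i} {j} i≢j eq Qi⊆Qj =
    x∉p-x (upper (cover i)) i (subst (i ∈ₛ_) (sym eq) (x∈p∧x≢y⇒x∈p-y (Qi⊆Qj (i∈upper (cover i))) i≢j))

  lower-injective : Injective _≡_ _≡_ lower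
  lower-injective {i} {j} eq with i ≟ᶠ j
  ... | yes i≡j = i≡j
  ... | no i≢j  = ⊥-elim (free (v₂ (lower∈ (cover i)) (upper∈ (cover i)) (upper∈ (cover j))
                    ( p─q⊆p _ _ , (λ y∈ → p─q⊆p _ _ (subst (_ ∈ₛ_) eq y∈))
                    , upper⊈upper i≢j eq , upper⊈upper (i≢j ∘ sym) (sym eq) )))

  bound : suc n ≤ length F
  bound = injective⇒≤length (⊤ ◂ lower) (◂-injective (λ _ → ⊤≢p-x) lower-injective) ⊤◂lower∈F
    where
    ⊤◂lower∈F : ∀ i → (⊤ ◂ lower) i ∈ F
    ⊤◂lower∈F zero    = ⊤∈F
    ⊤◂lower∈F (suc i) = lower∈ (cover i)

-- The V₂-saturated family {[n]} ∪ {[n] ∖ {i}}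

topAndCoatom : Fin (suc n) → Subset n
topAndCoatom = ⊤ ◂ (⊤ -_)

topAndCoatoms : (n : ℕ) → Family n
topAndCoatoms n = tabulate topAndCoatom

∈topAndCoatoms : ∀ k → topAndCoatom k ∈ topAndCoatoms n
∈topAndCoatoms = ∈-tabulate⁺

∈topAndCoatoms⁻ : {A : Subset n} → A ∈ topAndCoatoms n → ∃ λ k → A ≡ topAndCoatom k
∈topAndCoatoms⁻ = ∈-tabulate⁻

topAndCoatom-injective : Injective _≡_ _≡_ (topAndCoatom {n})
topAndCoatom-injective = ◂-injective (λ _ → ⊤≢p-x) ⊤-x-injective

coatoms-IsV₂ : ∀ {A : Subset n} {i j} → i ≢ j → i ∉ₛ A → j ∉ₛ A → IsV₂ A (⊤ - i) (⊤ - j)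
coatoms-IsV₂ i≢j i∉A j∉A =
  p⊆q∧x∉p⇒p⊆q-x ⊆⊤ i∉A , p⊆q∧x∉p⇒p⊆q-x ⊆⊤ j∉A , i≢j ∘ ⊤-x⊆⊤-y⇒x≡y , i≢j ∘ sym ∘ ⊤-x⊆⊤-y⇒x≡y

topAndCoatoms-V₂-free : ¬ V₂In (topAndCoatoms n)
topAndCoatoms-V₂-free (v₂ Z∈ D∈ _ V) with ∈topAndCoatoms⁻ Z∈ | ∈topAndCoatoms⁻ D∈
... | zero  , refl | _            = IsV₂⇒bot≢⊤ V refl
... | suc _ , refl | zero  , refl = IsV₂⇒top≢⊤ V refl
... | suc _ , refl | suc _ , refl = IsV₂⇒bot≢top V (cong (⊤ -_) (⊤-x⊆⊤-y⇒x≡y (proj₁ V)))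

topAndCoatoms-saturated : InducedSaturated V₂ n (topAndCoatoms n)
topAndCoatoms-saturated {n} = topAndCoatoms-V₂-free ∘ copy⇒V₂In , extend
  where
  extend : ∀ F′ → (∀ {A} → A ∈ topAndCoatoms n → A ∈ F′) →
           (∃ λ A → A ∈ F′ × A ∉ topAndCoatoms n) → HasInducedCopy V₂ F′
  extend F′ ⊇ (A , A∈F′ , A∉) = missing (p⊆q∧p≢q⇒p⊂q ⊆⊤ (A≢ zero))
    where
    A≢ : ∀ k → A ≢ topAndCoatom k
    A≢ k refl = A∉ (∈topAndCoatoms k)

    missing : A ⊂ ⊤ → HasInducedCopy V₂ F′
    missing (_ , i , _ , i∉A) with p⊆q∧p≢q⇒p⊂q (p⊆q∧x∉p⇒p⊆q-x ⊆⊤ i∉A) (A≢ (suc i))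
    ... | _ , j , j∈⊤-i , j∉A =
      V₂In⇒copy (v₂ A∈F′ (⊇ (∈topAndCoatoms (suc i))) (⊇ (∈topAndCoatoms (suc j)))
                    (coatoms-IsV₂ (x∈p-y⇒x≢y j∈⊤-i ∘ sym) i∉A j∉A))

satStar-V₂ : ∀ n → SatStarIs V₂ n (suc n)
satStar-V₂ n =
    (topAndCoatoms n , tabulate⁺ topAndCoatom-injective , topAndCoatoms-saturated , length-tabulate topAndCoatom)
  , λ _ _ saturated → LowerBound.bound saturated

-- Duality by complementation

∈-map-∁⁻ : {F : Family n} {A : Subset n} → A ∈ map ∁ F → ∁ A ∈ F
∈-map-∁⁻ {F = F} A∈ with ∈-map⁻ ∁ A∈
... | B , B∈ , refl = subst (_∈ F) (sym (∁-involutive B)) B∈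

∈-map-∁⁺ : {F : Family n} {A : Subset n} → ∁ A ∈ F → A ∈ map ∁ F
∈-map-∁⁺ {F = F} {A} ∁A∈ = subst (_∈ map ∁ F) (∁-involutive A) (∈-map⁺ ∁ ∁A∈)

Opposite : ∀ {k} → (Fin k → Fin k) → (P Q : Fin k → Fin k → Bool) → Set
Opposite σ P Q = ∀ u v → P u v ≡ Q (σ v) (σ u)

module _ {k} {σ : Fin k → Fin k} (σσ : Involutive _≡_ σ) where

  opposite-sym : ∀ {P Q} → Opposite σ P Q → Opposite σ Q P
  opposite-sym {P} {Q} P~Q u v = begin
    Q u v                 ≡⟨ cong₂ Q (σσ u) (σσ v) ⟨
    Q (σ (σ u)) (σ (σ v)) ≡⟨ P~Q (σ v) (σ u) ⟨
    P (σ v) (σ u)         ∎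
    where open ≡-Reasoning

  copy-∁ : ∀ {P Q} {F H : Family n} → Opposite σ P Q →
           HasInducedCopy Q F → (∀ {A} → A ∈ F → ∁ A ∈ H) → HasInducedCopy P H
  copy-∁ {P = P} P~Q (f , f-inj , f∈ , f-induced) ∁∈ = g , g-inj , ∁∈ ∘ f∈ ∘ σ , g-induced
    where
    g : Fin k → Subset _
    g u = ∁ (f (σ u))

    g-inj : Injective _≡_ _≡_ g
    g-inj {u} {v} eq = begin
      u         ≡⟨ σσ u ⟨
      σ (σ u)   ≡⟨ cong σ (f-inj (∁-injective eq)) ⟩
      σ (σ v)   ≡⟨ σσ v ⟩
      v         ∎
      where open ≡-Reasoning

    g-induced : ∀ u v → T (P u v) ⇔ (g u ⊆ g v)
    g-induced u v rewrite P~Q u v = mk⇔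
      (λ t {_} → p⊆q⇒∁p⊇∁q (Equivalence.to (f-induced (σ v) (σ u)) t))
      (λ gu⊆gv → Equivalence.from (f-induced (σ v) (σ u)) (∁p⊆∁q⇒p⊇q λ {x} → gu⊆gv {x}))

  saturated-∁ : ∀ {P Q} {F : Family n} → Opposite σ P Q →
                InducedSaturated Q n F → InducedSaturated P n (map ∁ F)
  saturated-∁ P~Q (free , saturated) =
      (λ copy → free (copy-∁ (opposite-sym P~Q) copy ∈-map-∁⁻))
    , λ F′ ⊇ (A , A∈F′ , A∉) →
        copy-∁ P~Q
          (saturated (map ∁ F′) (λ B∈ → ∈-map-∁⁺ (⊇ (∈-map⁺ ∁ B∈)))
                     (∁ A , ∈-map⁺ ∁ A∈F′ , A∉ ∘ ∈-map-∁⁺))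
          ∈-map-∁⁻

  satStar-opposite : ∀ {P Q n m} → Opposite σ P Q → SatStarIs Q n m → SatStarIs P n m
  satStar-opposite {m = m} P~Q ((F , unique , saturated , length≡m) , minimal) =
      (map ∁ F , map⁺ ∁-injective unique , saturated-∁ P~Q saturated , trans (length-map ∁ F) length≡m)
    , λ F′ unique′ saturated′ → subst (m ≤_) (length-map ∁ F′)
        (minimal (map ∁ F′) (map⁺ ∁-injective unique′) (saturated-∁ (opposite-sym P~Q) saturated′))

-- On Fin 3, opposite exchanges 0 and 2.
Λ₂-opposite-V₂ : Opposite opposite Λ₂ V₂
Λ₂-opposite-V₂ zero             zero             = refl
Λ₂-opposite-V₂ zero             (suc zero)       = refl
Λ₂-opposite-V₂ zero             (suc (suc zero)) = refl
Λ₂-opposite-V₂ (suc zero)       zero             = refl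
Λ₂-opposite-V₂ (suc zero)       (suc zero)       = refl
Λ₂-opposite-V₂ (suc zero)       (suc (suc zero)) = refl
Λ₂-opposite-V₂ (suc (suc zero)) zero             = refl
Λ₂-opposite-V₂ (suc (suc zero)) (suc zero)       = refl
Λ₂-opposite-V₂ (suc (suc zero)) (suc (suc zero)) = refl

theorem4 : ∀ (n : ℕ) → 2 ≤ n → SatStarIs V₂ n (suc n) × SatStarIs Λ₂ n (suc n)
theorem4 n _ = satStar-V₂ n , satStar-opposite opposite-involutive Λ₂-opposite-V₂ (satStar-V₂ n)
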